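{- Let $A$ be a type such that $[[0,0]]\le^a A$. Then $A$ is atomic.
   Context: Simply typed $\lambda$-calculus over base type $0$; every type is uniquely $[B_1,\dots,B_m]:=B_1\to\cdots\to B_m\to0$; $1:=[0]$, $[0,0]=0\to0\to0$. A context $\Gamma=x_1^{C_1},\dots,x_k^{C_k}$ is a finite list of distinct typed variables, $\{\Gamma\}$ its set, $[\Gamma]:=[C_1,\dots,C_k]$; terms identified up to $\beta\eta$ ($=_{\beta\eta}$); $\Lambda^\Xi(A)$ = terms of type $A$ with free variables in $\{\Xi\}$. A substitution $\varrho$ from $\Gamma$ to $\Delta$ assigns $\varrho_c\in\Lambda^\Delta(C)$ to each $c^C\in\{\Gamma\}$; for a fresh context $\Xi$, $\varrho^\Xi$ is $\varrho$ on $\{\Gamma\}$ and the identity on $\{\Xi\}$. $\varrho$ is an atomic reduction if for every fresh $\Xi$, all $a^A,b^B\in\{\Xi,\Gamma\}$ with $A\equiv[A_1,\dots,A_n]$, $B\equiv[B_1,\dots,B_m]$, and all $M_i\in\Lambda^{\Xi,\Delta}(A_i)$, $N_i\in\Lambda^{\Xi,\Delta}(B_i)$: $\varrho^\Xi_aM_1\cdots M_n=_{\beta\eta}\varrho^\Xi_bN_1\cdots N_m$ implies $a=b$ and all $M_i=N_i$. For types, $[\Gamma]\le^a[\Delta]$ means an atomic reduction from the context $\Gamma$ to the context $\Delta$ exists. A type $A$ is atomic if $[1,1]\le^a A$. -}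

module Defs where

open import Data.List using (List; []; _∷_; foldr)
import Data.List
open import Data.List.Relation.Unary.All using (All; []; _∷_)
open import Data.List.Relation.Binary.Pointwise using (Pointwise)
open import Data.Product using (Σ; ∃; _×_; _,_)
open import Relation.Binary.PropositionalEquality using (_≡_)

-- Simple types over the base type 0 (written ι).
infixr 7 _⇒_
data Ty : Set where
  ι   : Ty
  _⇒_ : Ty → Ty → Ty

-- [B₁,…,Bₘ] := B₁ → ⋯ → Bₘ → 0
⟦_⟧ : List Ty → Ty
⟦ Bs ⟧ = foldr _⇒_ ι Bs

-- the unique list of argument types: A ≡ ⟦ args A ⟧
args : Ty → List Ty
args ι       = []
args (A ⇒ B) = A ∷ args B

Ctx : Set
Ctx = List Ty

infix 4 _∋_
data _∋_ : Ctx → Ty → Set where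
  Z : ∀ {Γ A} → (A ∷ Γ) ∋ A
  S : ∀ {Γ A B} → Γ ∋ A → (B ∷ Γ) ∋ A

-- Intrinsically typed terms: Tm Γ A = Λ^Γ(A) before quotienting.
data Tm (Γ : Ctx) : Ty → Set where
  var : ∀ {A} → Γ ∋ A → Tm Γ A
  lam : ∀ {A B} → Tm (A ∷ Γ) B → Tm Γ (A ⇒ B)
  app : ∀ {A B} → Tm Γ (A ⇒ B) → Tm Γ A → Tm Γ B

Ren : Ctx → Ctx → Set
Ren Γ Δ = ∀ {A} → Γ ∋ A → Δ ∋ A

extR : ∀ {Γ Δ B} → Ren Γ Δ → Ren (B ∷ Γ) (B ∷ Δ)
extR ρ Z     = Z
extR ρ (S x) = S (ρ x)

rename : ∀ {Γ Δ A} → Ren Γ Δ → Tm Γ A → Tm Δ A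
rename ρ (var x)   = var (ρ x)
rename ρ (lam t)   = lam (rename (extR ρ) t)
rename ρ (app t u) = app (rename ρ t) (rename ρ u)

Sub : Ctx → Ctx → Set
Sub Γ Δ = ∀ {C} → Γ ∋ C → Tm Δ C

extS : ∀ {Γ Δ B} → Sub Γ Δ → Sub (B ∷ Γ) (B ∷ Δ)
extS σ Z     = var Z
extS σ (S x) = rename S (σ x)

subst : ∀ {Γ Δ A} → Sub Γ Δ → Tm Γ A → Tm Δ A
subst σ (var x)   = σ x
subst σ (lam t)   = lam (subst (extS σ) t)
subst σ (app t u) = app (subst σ t) (subst σ u)

sub0 : ∀ {Γ A} → Tm Γ A → Sub (A ∷ Γ) Γ
sub0 u Z     = u
sub0 u (S x) = var x

_[_] : ∀ {Γ A B} → Tm (A ∷ Γ) B → Tm Γ A → Tm Γ B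
t [ u ] = subst (sub0 u) t

infix 4 _≈_
data _≈_ {Γ : Ctx} : ∀ {A} → Tm Γ A → Tm Γ A → Set where
  β      : ∀ {A B} (t : Tm (A ∷ Γ) B) (u : Tm Γ A) → app (lam t) u ≈ t [ u ]
  η      : ∀ {A B} (t : Tm Γ (A ⇒ B)) → t ≈ lam (app (rename S t) (var Z))
  ≈-refl  : ∀ {A} {t : Tm Γ A} → t ≈ t
  ≈-sym   : ∀ {A} {t u : Tm Γ A} → t ≈ u → u ≈ t
  ≈-trans : ∀ {A} {t u v : Tm Γ A} → t ≈ u → u ≈ v → t ≈ v
  lam-cong : ∀ {A B} {t t' : Tm (A ∷ Γ) B} → t ≈ t' → lam t ≈ lam t'
  app-cong : ∀ {A B} {t t' : Tm Γ (A ⇒ B)} {u u' : Tm Γ A} →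
             t ≈ t' → u ≈ u' → app t u ≈ app t' u'

Args : Ctx → Ty → Set
Args Γ A = All (Tm Γ) (args A)

apps : ∀ {Γ A} → Tm Γ A → Args Γ A → Tm Γ ι
apps {A = ι}     t []       = t
apps {A = A ⇒ B} t (u ∷ us) = apps (app t u) us

data _≈*_ {Γ : Ctx} : ∀ {As} → All (Tm Γ) As → All (Tm Γ) As → Set where
  []  : [] ≈* []
  _∷_ : ∀ {A As} {M N : Tm Γ A} {Ms Ns : All (Tm Γ) As} →
        M ≈ N → Ms ≈* Ns → (M ∷ Ms) ≈* (N ∷ Ns)

-- "a = b and Mᵢ = Nᵢ for all i" for heads a^A, b^B (possibly of different types)
data SameHeadArgs {Γ Θ : Ctx} : ∀ {A B} → Γ ∋ A → Args Θ A → Γ ∋ B → Args Θ B → Set where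
  same : ∀ {A} {a : Γ ∋ A} {Ms Ns : Args Θ A} → Ms ≈* Ns → SameHeadArgs a Ms a Ns

-- ϱ^Ξ : identity on the fresh context Ξ, ϱ on Γ (context Ξ,Γ written Ξ ++ Γ)
_^_ : ∀ {Γ Δ} → Sub Γ Δ → (Ξ : Ctx) → Sub (Ξ Data.List.++ Γ) (Ξ Data.List.++ Δ)
ϱ ^ []      = ϱ
ϱ ^ (B ∷ Ξ) = extS (ϱ ^ Ξ)

IsAtomicReduction : ∀ {Γ Δ} → Sub Γ Δ → Set
IsAtomicReduction {Γ} {Δ} ϱ =
  ∀ (Ξ : Ctx) {A B} (a : (Ξ Data.List.++ Γ) ∋ A) (b : (Ξ Data.List.++ Γ) ∋ B)
    (Ms : Args (Ξ Data.List.++ Δ) A) (Ns : Args (Ξ Data.List.++ Δ) B) →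
    apps ((ϱ ^ Ξ) a) Ms ≈ apps ((ϱ ^ Ξ) b) Ns → SameHeadArgs a Ms b Ns

infix 4 _≤ᵃ_
_≤ᵃ_ : Ty → Ty → Set
C ≤ᵃ D = Σ Ctx λ Γ → Σ Ctx λ Δ → ⟦ Γ ⟧ ≡ C × ⟦ Δ ⟧ ≡ D ×
           Σ (Sub Γ Δ) IsAtomicReduction

𝟙 : Ty
𝟙 = ⟦ ι ∷ [] ⟧

𝟘𝟘 : Ty
𝟘𝟘 = ⟦ ι ∷ ι ∷ [] ⟧

Atomic : Ty → Set
Atomic A = ⟦ 𝟙 ∷ 𝟙 ∷ [] ⟧ ≤ᵃ A

module Submission where

-- Let ϱ be an atomic reduction from x : [0,0] to Δ and write X := ϱ x.  Then
-- f ↦ λz. X z z and g ↦ λz. X (X z z) z is an atomic reduction from f, g : 1 to Δ: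
-- atomicity of ϱ strips the head X from any equation between the images and leaves
-- either the equations of the arguments themselves or, when f is compared with g,
-- M = X N N together with M = N.  The fixpoint N = X N N is impossible.  The normal
-- form of X is λuv. E with both u and v occurring in E (otherwise X would not be
-- injective in that argument).  In the set-theoretic model over ℕ in which every
-- variable of higher type denotes a generic function, a neutral term of base type
-- denotes a number strictly above the value of every base variable occurring in it,
-- so the value of X N N is strictly above that of N.

open import Defs
open import Data.List using ([]; _∷_; _++_)
open import Data.List.Relation.Unary.All using ([]; _∷_)
open import Data.Nat using (ℕ; suc; _+_; _≤_; _<_; s≤s)
open import Data.Nat.Properties using (≤-refl; ≤-trans; m≤m+n; m≤n+m; n≤1+n; <-irrefl)
open import Data.Unit using (⊤; tt)
open import Data.Empty using (⊥; ⊥-elim)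
open import Data.Product using (Σ; _×_; _,_; proj₁; proj₂)
open import Relation.Nullary using (¬_)
open import Relation.Binary.Bundles using (Setoid)
import Relation.Binary.Reasoning.Setoid as SetoidReasoning
open import Relation.Binary.PropositionalEquality
  using (_≡_; _≢_; refl; sym; trans; cong; cong₂; module ≡-Reasoning)
  renaming (subst to transport)

-- Renaming and substitution

infix 4 _≗ʳ_ _≗ˢ_

_≗ʳ_ : ∀ {Γ Δ} → Ren Γ Δ → Ren Γ Δ → Set
ρ ≗ʳ ρ' = ∀ {A} (x : _ ∋ A) → ρ x ≡ ρ' x

_≗ˢ_ : ∀ {Γ Δ} → Sub Γ Δ → Sub Γ Δ → Set
σ ≗ˢ σ' = ∀ {A} (x : _ ∋ A) → σ x ≡ σ' x

extR-cong : ∀ {Γ Δ B} {ρ ρ' : Ren Γ Δ} → ρ ≗ʳ ρ' → extR {B = B} ρ ≗ʳ extR ρ'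
extR-cong p Z     = refl
extR-cong p (S x) = cong S (p x)

rename-cong : ∀ {Γ Δ A} {ρ ρ' : Ren Γ Δ} → ρ ≗ʳ ρ' → (t : Tm Γ A) → rename ρ t ≡ rename ρ' t
rename-cong p (var x)   = cong var (p x)
rename-cong p (lam t)   = cong lam (rename-cong (extR-cong p) t)
rename-cong p (app t u) = cong₂ app (rename-cong p t) (rename-cong p u)

rename-rename : ∀ {Γ Δ Θ A} (ρ' : Ren Δ Θ) (ρ : Ren Γ Δ) (t : Tm Γ A) →
  rename ρ' (rename ρ t) ≡ rename (λ x → ρ' (ρ x)) t
rename-rename ρ' ρ (var x)   = refl
rename-rename ρ' ρ (lam t)   =
  cong lam (trans (rename-rename (extR ρ') (extR ρ) t) (rename-cong (λ { Z → refl ; (S x) → refl }) t))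
rename-rename ρ' ρ (app t u) = cong₂ app (rename-rename ρ' ρ t) (rename-rename ρ' ρ u)

rename-id : ∀ {Γ A} (t : Tm Γ A) → rename (λ x → x) t ≡ t
rename-id (var x)   = refl
rename-id (lam t)   = cong lam (trans (rename-cong (λ { Z → refl ; (S x) → refl }) t) (rename-id t))
rename-id (app t u) = cong₂ app (rename-id t) (rename-id u)

extS-cong : ∀ {Γ Δ B} {σ σ' : Sub Γ Δ} → σ ≗ˢ σ' → extS {B = B} σ ≗ˢ extS σ'
extS-cong p Z     = refl
extS-cong p (S x) = cong (rename S) (p x)

subst-cong : ∀ {Γ Δ A} {σ σ' : Sub Γ Δ} → σ ≗ˢ σ' → (t : Tm Γ A) → subst σ t ≡ subst σ' t
subst-cong p (var x)   = p x
subst-cong p (lam t)   = cong lam (subst-cong (extS-cong p) t)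
subst-cong p (app t u) = cong₂ app (subst-cong p t) (subst-cong p u)

subst-rename : ∀ {Γ Δ Θ A} (σ : Sub Δ Θ) (ρ : Ren Γ Δ) (t : Tm Γ A) →
  subst σ (rename ρ t) ≡ subst (λ x → σ (ρ x)) t
subst-rename σ ρ (var x)   = refl
subst-rename σ ρ (lam t)   =
  cong lam (trans (subst-rename (extS σ) (extR ρ) t) (subst-cong (λ { Z → refl ; (S x) → refl }) t))
subst-rename σ ρ (app t u) = cong₂ app (subst-rename σ ρ t) (subst-rename σ ρ u)

rename-subst : ∀ {Γ Δ Θ A} (ρ : Ren Δ Θ) (σ : Sub Γ Δ) (t : Tm Γ A) →
  rename ρ (subst σ t) ≡ subst (λ x → rename ρ (σ x)) t
rename-subst ρ σ (var x)   = refl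
rename-subst ρ σ (lam t)   = cong lam (trans (rename-subst (extR ρ) (extS σ) t) (subst-cong ext-comm t))
  where
  ext-comm : (λ x → rename (extR ρ) (extS σ x)) ≗ˢ extS (λ x → rename ρ (σ x))
  ext-comm Z     = refl
  ext-comm (S x) = trans (rename-rename (extR ρ) S (σ x)) (sym (rename-rename S ρ (σ x)))
rename-subst ρ σ (app t u) = cong₂ app (rename-subst ρ σ t) (rename-subst ρ σ u)

subst-subst : ∀ {Γ Δ Θ A} (σ : Sub Δ Θ) (τ : Sub Γ Δ) (t : Tm Γ A) →
  subst σ (subst τ t) ≡ subst (λ x → subst σ (τ x)) t
subst-subst σ τ (var x)   = refl
subst-subst σ τ (lam t)   = cong lam (trans (subst-subst (extS σ) (extS τ) t) (subst-cong ext-comm t))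
  where
  ext-comm : (λ x → subst (extS σ) (extS τ x)) ≗ˢ extS (λ x → subst σ (τ x))
  ext-comm Z     = refl
  ext-comm (S x) = trans (subst-rename (extS σ) S (τ x)) (sym (rename-subst S σ (τ x)))
subst-subst σ τ (app t u) = cong₂ app (subst-subst σ τ t) (subst-subst σ τ u)

subst-var∘ : ∀ {Γ Δ A} (ρ : Ren Γ Δ) (t : Tm Γ A) → subst (λ x → var (ρ x)) t ≡ rename ρ t
subst-var∘ ρ (var x)   = refl
subst-var∘ ρ (lam t)   =
  cong lam (trans (subst-cong (λ { Z → refl ; (S x) → refl }) t) (subst-var∘ (extR ρ) t))
subst-var∘ ρ (app t u) = cong₂ app (subst-var∘ ρ t) (subst-var∘ ρ u)

subst-id : ∀ {Γ A} (t : Tm Γ A) → subst var t ≡ t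
subst-id t = trans (subst-var∘ (λ x → x) t) (rename-id t)

subst-sub0-weaken : ∀ {Γ Δ A B} (ρ : Ren Γ Δ) (M : Tm Δ B) (t : Tm Γ A) →
  subst (sub0 M) (rename (extR ρ) (rename S t)) ≡ rename ρ t
subst-sub0-weaken ρ M t = begin
  subst (sub0 M) (rename (extR ρ) (rename S t)) ≡⟨ cong (subst (sub0 M)) (rename-rename (extR ρ) S t) ⟩
  subst (sub0 M) (rename (λ x → S (ρ x)) t)     ≡⟨ subst-rename (sub0 M) _ t ⟩
  subst (λ x → var (ρ x)) t                     ≡⟨ subst-var∘ ρ t ⟩
  rename ρ t                                    ∎
  where open ≡-Reasoning

≡⇒≈ : ∀ {Γ A} {t u : Tm Γ A} → t ≡ u → t ≈ u
≡⇒≈ refl = ≈-refl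

≈-resp₂ : ∀ {Γ A} {t t' u u' : Tm Γ A} → t ≈ t' → u ≈ u' → t ≈ u → t' ≈ u'
≈-resp₂ p q r = ≈-trans (≈-sym p) (≈-trans r q)

≈-setoid : Ctx → Ty → Setoid _ _
≈-setoid Γ A = record
  { Carrier       = Tm Γ A
  ; _≈_           = _≈_
  ; isEquivalence = record { refl = ≈-refl ; sym = ≈-sym ; trans = ≈-trans }
  }

module ≈-Reasoning {Γ : Ctx} {A : Ty} = SetoidReasoning (≈-setoid Γ A)

≈-rename : ∀ {Γ Δ A} (ρ : Ren Γ Δ) {t u : Tm Γ A} → t ≈ u → rename ρ t ≈ rename ρ u
≈-rename ρ (β t u) = ≈-trans (β (rename (extR ρ) t) (rename ρ u)) (≡⇒≈ (begin
  subst (sub0 (rename ρ u)) (rename (extR ρ) t)    ≡⟨ subst-rename (sub0 (rename ρ u)) (extR ρ) t ⟩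
  subst (λ x → sub0 (rename ρ u) (extR ρ x)) t     ≡⟨ subst-cong (λ { Z → refl ; (S x) → refl }) t ⟩
  subst (λ x → rename ρ (sub0 u x)) t              ≡⟨ rename-subst ρ (sub0 u) t ⟨
  rename ρ (subst (sub0 u) t)                      ∎))
  where open ≡-Reasoning
≈-rename ρ (η t) = ≈-trans (η (rename ρ t))
  (≡⇒≈ (cong (λ s → lam (app s (var Z))) (trans (rename-rename S ρ t) (sym (rename-rename (extR ρ) S t)))))
≈-rename ρ ≈-refl         = ≈-refl
≈-rename ρ (≈-sym p)      = ≈-sym (≈-rename ρ p)
≈-rename ρ (≈-trans p q)  = ≈-trans (≈-rename ρ p) (≈-rename ρ q)
≈-rename ρ (lam-cong p)   = lam-cong (≈-rename (extR ρ) p)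
≈-rename ρ (app-cong p q) = app-cong (≈-rename ρ p) (≈-rename ρ q)

sub₂ : ∀ {Γ Θ A B} → Ren Γ Θ → Tm Θ B → Tm Θ A → Sub (A ∷ B ∷ Γ) Θ
sub₂ ρ M N Z         = N
sub₂ ρ M N (S Z)     = M
sub₂ ρ M N (S (S x)) = var (ρ x)

β₂-rename : ∀ {Γ Θ A B C} (ρ : Ren Γ Θ) (t : Tm (A ∷ B ∷ Γ) C) (M : Tm Θ B) (N : Tm Θ A) →
  app (app (rename ρ (lam (lam t))) M) N ≈ subst (sub₂ ρ M N) t
β₂-rename ρ t M N = ≈-trans (app-cong (β _ M) ≈-refl) (≈-trans (β _ N) (≡⇒≈ (begin
  subst (sub0 N) (subst (extS (sub0 M)) (rename (extR (extR ρ)) t))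
    ≡⟨ subst-subst (sub0 N) (extS (sub0 M)) (rename (extR (extR ρ)) t) ⟩
  subst (λ x → subst (sub0 N) (extS (sub0 M) x)) (rename (extR (extR ρ)) t)
    ≡⟨ subst-rename _ (extR (extR ρ)) t ⟩
  subst (λ x → subst (sub0 N) (extS (sub0 M) (extR (extR ρ) x))) t
    ≡⟨ subst-cong agree t ⟩
  subst (sub₂ ρ M N) t
    ∎)))
  where
  open ≡-Reasoning
  agree : (λ x → subst (sub0 N) (extS (sub0 M) (extR (extR ρ) x))) ≗ˢ sub₂ ρ M N
  agree Z         = refl
  agree (S Z)     = trans (subst-rename (sub0 N) S M) (subst-id M)
  agree (S (S x)) = refl

-- Normalisation by evaluation

mutual
  data Ne (Γ : Ctx) : Ty → Set where
    nvar : ∀ {A} → Γ ∋ A → Ne Γ A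
    napp : ∀ {A B} → Ne Γ (A ⇒ B) → Nf Γ A → Ne Γ B

  data Nf (Γ : Ctx) : Ty → Set where
    ne   : Ne Γ ι → Nf Γ ι
    nlam : ∀ {A B} → Nf (A ∷ Γ) B → Nf Γ (A ⇒ B)

mutual
  embNe : ∀ {Γ A} → Ne Γ A → Tm Γ A
  embNe (nvar x)   = var x
  embNe (napp e m) = app (embNe e) (embNf m)

  embNf : ∀ {Γ A} → Nf Γ A → Tm Γ A
  embNf (ne e)   = embNe e
  embNf (nlam m) = lam (embNf m)

mutual
  renNe : ∀ {Γ Δ A} → Ren Γ Δ → Ne Γ A → Ne Δ A
  renNe ρ (nvar x)   = nvar (ρ x)
  renNe ρ (napp e m) = napp (renNe ρ e) (renNf ρ m)

  renNf : ∀ {Γ Δ A} → Ren Γ Δ → Nf Γ A → Nf Δ A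
  renNf ρ (ne e)   = ne (renNe ρ e)
  renNf ρ (nlam m) = nlam (renNf (extR ρ) m)

mutual
  embNe-rename : ∀ {Γ Δ A} (ρ : Ren Γ Δ) (e : Ne Γ A) → embNe (renNe ρ e) ≡ rename ρ (embNe e)
  embNe-rename ρ (nvar x)   = refl
  embNe-rename ρ (napp e m) = cong₂ app (embNe-rename ρ e) (embNf-rename ρ m)

  embNf-rename : ∀ {Γ Δ A} (ρ : Ren Γ Δ) (m : Nf Γ A) → embNf (renNf ρ m) ≡ rename ρ (embNf m)
  embNf-rename ρ (ne e)   = embNe-rename ρ e
  embNf-rename ρ (nlam m) = cong lam (embNf-rename (extR ρ) m)

Val : Ty → Ctx → Set
Val ι       Γ = Nf Γ ι
Val (A ⇒ B) Γ = ∀ {Δ} → Ren Γ Δ → Val A Δ → Val B Δ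

renV : ∀ {A Γ Δ} → Ren Γ Δ → Val A Γ → Val A Δ
renV {ι}     ρ v = renNf ρ v
renV {A ⇒ B} ρ f = λ ρ' a → f (λ x → ρ' (ρ x)) a

mutual
  reflect : ∀ {A Γ} → Ne Γ A → Val A Γ
  reflect {ι}     e = ne e
  reflect {A ⇒ B} e = λ ρ a → reflect (napp (renNe ρ e) (reify a))

  reify : ∀ {A Γ} → Val A Γ → Nf Γ A
  reify {ι}     v = v
  reify {A ⇒ B} f = nlam (reify (f S (reflect (nvar Z))))

Env : Ctx → Ctx → Set
Env Γ Δ = ∀ {C} → Γ ∋ C → Val C Δ

extE : ∀ {Γ Δ A} → Env Γ Δ → Val A Δ → Env (A ∷ Γ) Δ
extE ε a Z     = a
extE ε a (S x) = ε x

eval : ∀ {Γ Δ A} → Tm Γ A → Env Γ Δ → Val A Δ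
eval (var x)   ε = ε x
eval (lam t)   ε = λ ρ a → eval t (extE (λ x → renV ρ (ε x)) a)
eval (app t u) ε = eval t ε (λ x → x) (eval u ε)

nf : ∀ {Γ A} → Tm Γ A → Nf Γ A
nf t = reify (eval t (λ x → reflect (nvar x)))

R : ∀ {Γ} A → Tm Γ A → Val A Γ → Set
R ι       t v = t ≈ embNf v
R {Γ} (A ⇒ B) t f = ∀ {Δ} (ρ : Ren Γ Δ) {u a} → R A u a → R B (app (rename ρ t) u) (f ρ a)

R-≈ : ∀ {Γ} A {t t' : Tm Γ A} {v} → t ≈ t' → R A t v → R A t' v
R-≈ ι       p r = ≈-trans (≈-sym p) r
R-≈ (A ⇒ B) p r = λ ρ q → R-≈ B (app-cong (≈-rename ρ p) ≈-refl) (r ρ q)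

R-≡ : ∀ {Γ} A {t t' : Tm Γ A} {v} → t ≡ t' → R A t v → R A t' v
R-≡ A refl r = r

R-rename : ∀ {Γ Δ} A (ρ : Ren Γ Δ) {t v} → R A t v → R A (rename ρ t) (renV ρ v)
R-rename ι       ρ {t} {v} r = transport (rename ρ t ≈_) (sym (embNf-rename ρ v)) (≈-rename ρ r)
R-rename (A ⇒ B) ρ {t} r = λ ρ' q → R-≡ B (cong (λ s → app s _) (sym (rename-rename ρ' ρ t))) (r _ q)

mutual
  reflect-R : ∀ {Γ} A (e : Ne Γ A) → R A (embNe e) (reflect e)
  reflect-R ι       e = ≈-refl
  reflect-R (A ⇒ B) e ρ {u} {a} q =
    R-≈ B (app-cong (≡⇒≈ (embNe-rename ρ e)) (≈-sym (reify-R A q)))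
      (reflect-R B (napp (renNe ρ e) (reify a)))

  reify-R : ∀ {Γ} A {t : Tm Γ A} {v} → R A t v → t ≈ embNf (reify v)
  reify-R ι       r = r
  reify-R (A ⇒ B) {t} r = ≈-trans (η t) (lam-cong (reify-R B (r S (reflect-R A (nvar Z)))))

R-subst : ∀ {Γ Δ A} (t : Tm Γ A) (σ : Sub Γ Δ) (ε : Env Γ Δ) →
  (∀ {C} (x : Γ ∋ C) → R C (σ x) (ε x)) → R A (subst σ t) (eval t ε)
R-subst (var x) σ ε h = h x
R-subst {A = A} (app t u) σ ε h =
  R-≡ A (cong (λ s → app s (subst σ u)) (rename-id (subst σ t)))
    (R-subst t σ ε h (λ x → x) (R-subst u σ ε h))
R-subst {Γ} {Δ} (lam {A} {B} t) σ ε h {Δ'} ρ {u} {a} q =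
  R-≈ B (≈-sym (β _ u)) (R-≡ B (sym eq) (R-subst t (σ⁺ u) (extE (λ x → renV ρ (ε x)) a) h⁺))
  where
  σ⁺ : Tm Δ' A → Sub (A ∷ Γ) Δ'
  σ⁺ u Z     = u
  σ⁺ u (S x) = rename ρ (σ x)

  h⁺ : ∀ {C} (x : (A ∷ Γ) ∋ C) → R C (σ⁺ u x) (extE (λ x → renV ρ (ε x)) a x)
  h⁺ Z         = q
  h⁺ {C} (S x) = R-rename C ρ (h x)

  eq : subst (sub0 u) (rename (extR ρ) (subst (extS σ) t)) ≡ subst (σ⁺ u) t
  eq = begin
    subst (sub0 u) (rename (extR ρ) (subst (extS σ) t))
      ≡⟨ cong (subst (sub0 u)) (rename-subst (extR ρ) (extS σ) t) ⟩
    subst (sub0 u) (subst (λ x → rename (extR ρ) (extS σ x)) t)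
      ≡⟨ subst-subst (sub0 u) _ t ⟩
    subst (λ x → subst (sub0 u) (rename (extR ρ) (extS σ x))) t
      ≡⟨ subst-cong (λ { Z → refl ; (S x) → subst-sub0-weaken ρ u (σ x) }) t ⟩
    subst (σ⁺ u) t
      ∎
    where open ≡-Reasoning

nf-sound : ∀ {Γ A} (t : Tm Γ A) → t ≈ embNf (nf t)
nf-sound {A = A} t =
  reify-R A (R-≡ A (subst-id t) (R-subst t var (λ x → reflect (nvar x)) (λ {C} x → reflect-R C (nvar x))))

body : ∀ {Γ} → Nf Γ 𝟘𝟘 → Ne (ι ∷ ι ∷ Γ) ι
body (nlam (nlam (ne e))) = e

embNf-𝟘𝟘 : ∀ {Γ} (m : Nf Γ 𝟘𝟘) → embNf m ≡ lam (lam (embNe (body m)))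
embNf-𝟘𝟘 (nlam (nlam (ne e))) = refl

mutual
  data OccNe {Γ} (y : Γ ∋ ι) : ∀ {A} → Ne Γ A → Set where
    here : OccNe y (nvar y)
    fun  : ∀ {A B} {e : Ne Γ (A ⇒ B)} {m} → OccNe y e → OccNe y (napp e m)
    arg  : ∀ {A B} {e : Ne Γ (A ⇒ B)} {m} → OccNf y m → OccNe y (napp e m)

  data OccNf {Γ} (y : Γ ∋ ι) : ∀ {A} → Nf Γ A → Set where
    ne  : ∀ {e} → OccNe y e → OccNf y (ne e)
    lam : ∀ {A B} {m : Nf (A ∷ Γ) B} → OccNf (S y) m → OccNf y (nlam m)

mutual
  subst-unused-ne : ∀ {Γ Δ A} {y : Γ ∋ ι} (e : Ne Γ A) → ¬ OccNe y e → (σ σ' : Sub Γ Δ) →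
    (∀ {C} (x : Γ ∋ C) → ¬ OccNe y (nvar x) → σ x ≡ σ' x) → subst σ (embNe e) ≡ subst σ' (embNe e)
  subst-unused-ne (nvar x)   n σ σ' h = h x n
  subst-unused-ne (napp e m) n σ σ' h =
    cong₂ app (subst-unused-ne e (λ o → n (fun o)) σ σ' h) (subst-unused-nf m (λ o → n (arg o)) σ σ' h)

  subst-unused-nf : ∀ {Γ Δ A} {y : Γ ∋ ι} (m : Nf Γ A) → ¬ OccNf y m → (σ σ' : Sub Γ Δ) →
    (∀ {C} (x : Γ ∋ C) → ¬ OccNe y (nvar x) → σ x ≡ σ' x) → subst σ (embNf m) ≡ subst σ' (embNf m)
  subst-unused-nf (ne e)   n σ σ' h = subst-unused-ne e (λ o → n (ne o)) σ σ' h
  subst-unused-nf {y = y} (nlam {A} m) n σ σ' h =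
    cong lam (subst-unused-nf m (λ o → n (lam o)) (extS σ) (extS σ') h⁺)
    where
    h⁺ : ∀ {C} (x : (A ∷ _) ∋ C) → ¬ OccNe (S y) (nvar x) → extS σ x ≡ extS σ' x
    h⁺ Z     _  = refl
    h⁺ (S x) nx = cong (rename S) (h x (λ { here → nx here }))

-- The full set-theoretic model over ℕ

Sm : Ty → Set
Sm ι       = ℕ
Sm (A ⇒ B) = Sm A → Sm B

-- Without function extensionality, soundness holds up to this logical relation.
_~_ : ∀ {A} → Sm A → Sm A → Set
_~_ {ι}     a b = a ≡ b
_~_ {A ⇒ B} f g = ∀ {a a'} → a ~ a' → f a ~ g a'

mutual
  ~-sym : ∀ {A} {a b : Sm A} → a ~ b → b ~ a
  ~-sym {ι}     p   = sym p
  ~-sym {A ⇒ B} p q = ~-sym {B} (p (~-sym {A} q))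

  ~-trans : ∀ {A} {a b c : Sm A} → a ~ b → b ~ c → a ~ c
  ~-trans {ι}     p q   = trans p q
  ~-trans {A ⇒ B} p q r = ~-trans {B} (p r) (q (~-trans {A} (~-sym {A} r) r))

~-reflˡ : ∀ {A} {a b : Sm A} → a ~ b → a ~ a
~-reflˡ {A} p = ~-trans {A} p (~-sym {A} p)

~-reflʳ : ∀ {A} {a b : Sm A} → a ~ b → b ~ b
~-reflʳ {A} p = ~-reflˡ {A} (~-sym {A} p)

SEnv : Ctx → Set
SEnv Γ = ∀ {C} → Γ ∋ C → Sm C

_▸_ : ∀ {Γ A} → SEnv Γ → Sm A → SEnv (A ∷ Γ)
(γ ▸ a) Z     = a
(γ ▸ a) (S x) = γ x

⟪_⟫ : ∀ {Γ A} → Tm Γ A → SEnv Γ → Sm A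
⟪ var x ⟫   γ = γ x
⟪ lam t ⟫   γ = λ a → ⟪ t ⟫ (γ ▸ a)
⟪ app t u ⟫ γ = ⟪ t ⟫ γ (⟪ u ⟫ γ)

_~ᴱ_ : ∀ {Γ} → SEnv Γ → SEnv Γ → Set
_~ᴱ_ {Γ} γ γ' = ∀ {C} (x : Γ ∋ C) → γ x ~ γ' x

~ᴱ-sym : ∀ {Γ} {γ γ' : SEnv Γ} → γ ~ᴱ γ' → γ' ~ᴱ γ
~ᴱ-sym h x = ~-sym {_} (h x)

~ᴱ-reflˡ : ∀ {Γ} {γ γ' : SEnv Γ} → γ ~ᴱ γ' → γ ~ᴱ γ
~ᴱ-reflˡ h x = ~-reflˡ {_} (h x)

~ᴱ-reflʳ : ∀ {Γ} {γ γ' : SEnv Γ} → γ ~ᴱ γ' → γ' ~ᴱ γ'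
~ᴱ-reflʳ h x = ~-reflʳ {_} (h x)

▸-cong : ∀ {Γ A} {γ γ' : SEnv Γ} {a a' : Sm A} → γ ~ᴱ γ' → a ~ a' → (γ ▸ a) ~ᴱ (γ' ▸ a')
▸-cong h p Z     = p
▸-cong h p (S x) = h x

⟪⟫-cong : ∀ {Γ A} (t : Tm Γ A) {γ γ' : SEnv Γ} → γ ~ᴱ γ' → ⟪ t ⟫ γ ~ ⟪ t ⟫ γ'
⟪⟫-cong (var x)   h = h x
⟪⟫-cong (lam t)   h p = ⟪⟫-cong t (▸-cong h p)
⟪⟫-cong (app t u) h = ⟪⟫-cong t h (⟪⟫-cong u h)

⟪rename⟫ : ∀ {Γ Δ A} (ρ : Ren Γ Δ) (t : Tm Γ A) {γ γ' : SEnv Δ} → γ ~ᴱ γ' →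
  ⟪ rename ρ t ⟫ γ ~ ⟪ t ⟫ (λ x → γ' (ρ x))
⟪rename⟫ ρ (var x)   h = h (ρ x)
⟪rename⟫ ρ (lam t)   h p =
  ~-trans {_} (⟪rename⟫ (extR ρ) t (▸-cong h p))
    (⟪⟫-cong t (λ { Z → ~-reflʳ {_} p ; (S x) → ~-reflʳ {_} (h (ρ x)) }))
⟪rename⟫ ρ (app t u) h = ⟪rename⟫ ρ t h (⟪rename⟫ ρ u h)

⟪subst⟫ : ∀ {Γ Δ A} (σ : Sub Γ Δ) (t : Tm Γ A) {γ γ' : SEnv Δ} → γ ~ᴱ γ' →
  ⟪ subst σ t ⟫ γ ~ ⟪ t ⟫ (λ x → ⟪ σ x ⟫ γ')
⟪subst⟫ σ (var x)   h = ⟪⟫-cong (σ x) h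
⟪subst⟫ σ (lam t)   h p =
  ~-trans {_} (⟪subst⟫ (extS σ) t (▸-cong h p))
    (⟪⟫-cong t (λ { Z → ~-reflʳ {_} p
                  ; (S x) → ~-trans {_} (⟪rename⟫ S (σ x) (▸-cong (~ᴱ-reflʳ h) (~-reflʳ {_} p)))
                                        (⟪⟫-cong (σ x) (~ᴱ-reflʳ h)) }))
⟪subst⟫ σ (app t u) h = ⟪subst⟫ σ t h (⟪subst⟫ σ u h)

⟪⟫-sound : ∀ {Γ A} {t u : Tm Γ A} → t ≈ u →
  ∀ {γ γ' : SEnv Γ} → γ ~ᴱ γ' → ⟪ t ⟫ γ ~ ⟪ u ⟫ γ'
⟪⟫-sound {A = A} (β t u) h =
  ~-sym {A} (~-trans {A} (⟪subst⟫ (sub0 u) t (~ᴱ-sym h))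
    (⟪⟫-cong t (λ { Z → ⟪⟫-cong u (~ᴱ-reflˡ h) ; (S x) → ~-reflˡ {_} (h x) })))
⟪⟫-sound (η t) h p =
  ~-trans {_} (⟪⟫-cong t h p)
    (~-sym {_} (⟪rename⟫ S t (▸-cong (~ᴱ-reflʳ h) (~-reflʳ {_} p)) (~-reflʳ {_} p)))
⟪⟫-sound {t = t} ≈-refl h = ⟪⟫-cong t h
⟪⟫-sound {A = A} (≈-sym p) h = ~-sym {A} (⟪⟫-sound p (~ᴱ-sym h))
⟪⟫-sound {A = A} (≈-trans p q) h = ~-trans {A} (⟪⟫-sound p (~ᴱ-reflˡ h)) (⟪⟫-sound q h)
⟪⟫-sound (lam-cong p) h q = ⟪⟫-sound p (▸-cong h q)
⟪⟫-sound (app-cong p q) h = ⟪⟫-sound p h (⟪⟫-sound q h)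

-- Generic values

-- gen C k is an element of C "at level k": a function adds the level (probe) of each
-- argument to its own, and at base type the accumulated level plus one is returned.
mutual
  gen : (C : Ty) → ℕ → Sm C
  gen ι       k = suc k
  gen (A ⇒ B) k = λ v → gen B (k + probe A v)

  probe : (A : Ty) → Sm A → ℕ
  probe ι       v = v
  probe (A ⇒ B) v = probe B (v (gen A 0))

mutual
  gen-cong : ∀ C {k k'} → k ≡ k' → gen C k ~ gen C k'
  gen-cong ι       p = cong suc p
  gen-cong (A ⇒ B) p q = gen-cong B (cong₂ _+_ p (probe-cong A q))

  probe-cong : ∀ A {a a' : Sm A} → a ~ a' → probe A a ≡ probe A a'
  probe-cong ι       p = p
  probe-cong (A ⇒ B) p = probe-cong B (p (gen-cong A refl))

generic : ∀ {Γ} → SEnv Γ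
generic {C = C} _ = gen C 0

generic-refl : ∀ {Γ} → generic {Γ} ~ᴱ generic
generic-refl {C = C} _ = gen-cong C refl

IsArrow : Ty → Set
IsArrow ι       = ⊥
IsArrow (_ ⇒ _) = ⊤

Good : ∀ {Γ} → SEnv Γ → Set
Good {Γ} γ = ∀ {C} (x : Γ ∋ C) → IsArrow C → γ x ≡ gen C 0

Good-▸ : ∀ {Γ A} {γ : SEnv Γ} → Good γ → Good (γ ▸ gen A 0)
Good-▸ g Z     _ = refl
Good-▸ g (S x) i = g x i

GenericAbove : ∀ {Γ C} → SEnv Γ → Ne Γ C → Set
GenericAbove {C = C} γ e = Σ ℕ λ k → ⟪ embNe e ⟫ γ ≡ gen C k × (∀ {y} → OccNe y e → γ y ≤ k)

mutual
  ne⇒-generic : ∀ {Γ A B} {γ : SEnv Γ} → Good γ → (e : Ne Γ (A ⇒ B)) → GenericAbove γ e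
  ne⇒-generic g (nvar x)   = 0 , g x tt , λ { () }
  ne⇒-generic g (napp e m) = napp-generic g e m

  napp-generic : ∀ {Γ A C} {γ : SEnv Γ} → Good γ → (e : Ne Γ (A ⇒ C)) (m : Nf Γ A) →
    GenericAbove γ (napp e m)
  napp-generic {A = A} {γ = γ} g e m with ne⇒-generic g e
  ... | k , eq , below =
    k + probe A (⟪ embNf m ⟫ γ) , cong (λ f → f (⟪ embNf m ⟫ γ)) eq ,
    λ { (fun o) → ≤-trans (below o) (m≤m+n _ _) ; (arg o) → ≤-trans (probe-above g m o) (m≤n+m _ _) }

  probe-above : ∀ {Γ A} {γ : SEnv Γ} → Good γ → (m : Nf Γ A) → ∀ {y} → OccNf y m →
    γ y ≤ probe A (⟪ embNf m ⟫ γ)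
  probe-above g (ne (nvar x)) (ne here) = ≤-refl
  probe-above {γ = γ} g (ne (napp e m)) {y} (ne o) with napp-generic g e m
  ... | k , eq , below = transport (γ y ≤_) (sym eq) (≤-trans (below o) (n≤1+n k))
  probe-above g (nlam m) (lam o) = probe-above (Good-▸ g) m o

occurring-<-ne : ∀ {Γ} {γ : SEnv Γ} {y y' : Γ ∋ ι} → Good γ → (e : Ne Γ ι) →
  OccNe y e → OccNe y' e → y ≢ y' → γ y < ⟪ embNe e ⟫ γ
occurring-<-ne g (nvar _) here here y≢y' = ⊥-elim (y≢y' refl)
occurring-<-ne {γ = γ} {y} g (napp e m) o _ _ with napp-generic g e m
... | k , eq , below = transport (γ y <_) (sym eq) (s≤s (below o))

-- Splitting the context Ξ ++ Γ

inl : (Ξ : Ctx) {Γ : Ctx} {C : Ty} → Ξ ∋ C → (Ξ ++ Γ) ∋ C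
inl (B ∷ Ξ) Z     = Z
inl (B ∷ Ξ) (S x) = S (inl Ξ x)

inr : (Ξ : Ctx) {Γ : Ctx} {C : Ty} → Γ ∋ C → (Ξ ++ Γ) ∋ C
inr []      c = c
inr (B ∷ Ξ) c = S (inr Ξ c)

data View (Ξ Γ : Ctx) {C : Ty} : (Ξ ++ Γ) ∋ C → Set where
  left  : (x : Ξ ∋ C) → View Ξ Γ (inl Ξ x)
  right : (c : Γ ∋ C) → View Ξ Γ (inr Ξ c)

view : (Ξ : Ctx) {Γ : Ctx} {C : Ty} (a : (Ξ ++ Γ) ∋ C) → View Ξ Γ a
view []      a = right a
view (B ∷ Ξ) Z = left Z
view (B ∷ Ξ) (S a) with view Ξ a
... | left x  = left (S x)
... | right c = right c

^-inl : (Ξ : Ctx) {Γ Δ : Ctx} (τ : Sub Γ Δ) {C : Ty} (x : Ξ ∋ C) → (τ ^ Ξ) (inl Ξ x) ≡ var (inl Ξ x)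
^-inl (B ∷ Ξ) τ Z     = refl
^-inl (B ∷ Ξ) τ (S x) = cong (rename S) (^-inl Ξ τ x)

^-inr : (Ξ : Ctx) {Γ Δ : Ctx} (τ : Sub Γ Δ) {C : Ty} (c : Γ ∋ C) →
  (τ ^ Ξ) (inr Ξ c) ≡ rename (inr Ξ) (τ c)
^-inr []      τ c = sym (rename-id (τ c))
^-inr (B ∷ Ξ) τ c = trans (cong (rename S) (^-inr Ξ τ c)) (rename-rename S (inr Ξ) (τ c))

SameHeadArgs⇒≈* : ∀ {Γ Θ A} {a : Γ ∋ A} {Ms Ns : Args Θ A} → SameHeadArgs a Ms a Ns → Ms ≈* Ns
SameHeadArgs⇒≈* (same p) = p

SameHeadArgs-S⁻ : ∀ {Γ Θ B A A'} {a : Γ ∋ A} {b : Γ ∋ A'} {Ms : Args Θ A} {Ns : Args Θ A'} →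
  SameHeadArgs {B ∷ Γ} (S a) Ms (S b) Ns → SameHeadArgs a Ms b Ns
SameHeadArgs-S⁻ (same p) = same p

SameHeadArgs-S : ∀ {Γ Θ B A A'} {a : Γ ∋ A} {b : Γ ∋ A'} {Ms : Args Θ A} {Ns : Args Θ A'} →
  SameHeadArgs a Ms b Ns → SameHeadArgs {B ∷ Γ} (S a) Ms (S b) Ns
SameHeadArgs-S (same p) = same p

SameHeadArgs-inl : (Ξ : Ctx) {Γ₁ Γ₂ Θ : Ctx} {A A' : Ty} (x : Ξ ∋ A) (y : Ξ ∋ A')
  {Ms : Args Θ A} {Ns : Args Θ A'} →
  SameHeadArgs (inl Ξ {Γ₁} x) Ms (inl Ξ y) Ns → SameHeadArgs (inl Ξ {Γ₂} x) Ms (inl Ξ y) Ns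
SameHeadArgs-inl (B ∷ Ξ) Z     Z     (same p) = same p
SameHeadArgs-inl (B ∷ Ξ) Z     (S y) ()
SameHeadArgs-inl (B ∷ Ξ) (S x) Z     ()
SameHeadArgs-inl (B ∷ Ξ) (S x) (S y) s = SameHeadArgs-S (SameHeadArgs-inl Ξ x y (SameHeadArgs-S⁻ s))

¬SameHeadArgs-inl-inr : (Ξ : Ctx) {Γ Θ : Ctx} {A A' : Ty} (x : Ξ ∋ A) (c : Γ ∋ A')
  {Ms : Args Θ A} {Ns : Args Θ A'} → ¬ SameHeadArgs (inl Ξ x) Ms (inr Ξ c) Ns
¬SameHeadArgs-inl-inr (B ∷ Ξ) Z     c ()
¬SameHeadArgs-inl-inr (B ∷ Ξ) (S x) c s = ¬SameHeadArgs-inl-inr Ξ x c (SameHeadArgs-S⁻ s)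

¬SameHeadArgs-inr-inl : (Ξ : Ctx) {Γ Θ : Ctx} {A A' : Ty} (x : Ξ ∋ A) (c : Γ ∋ A')
  {Ms : Args Θ A'} {Ns : Args Θ A} → ¬ SameHeadArgs (inr Ξ c) Ms (inl Ξ x) Ns
¬SameHeadArgs-inr-inl (B ∷ Ξ) Z     c ()
¬SameHeadArgs-inr-inl (B ∷ Ξ) (S x) c s = ¬SameHeadArgs-inr-inl Ξ x c (SameHeadArgs-S⁻ s)

-- From [[0,0]] to [1,1]

module Diagonal {Δ : Ctx} (ϱ : Sub (𝟘𝟘 ∷ []) Δ) (ϱ-atomic : IsAtomicReduction ϱ) where

  X : Tm Δ 𝟘𝟘
  X = ϱ Z

  X[_] : (Ξ : Ctx) → Tm (Ξ ++ Δ) ι → Tm (Ξ ++ Δ) ι → Tm (Ξ ++ Δ) ι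
  X[ Ξ ] M N = apps ((ϱ ^ Ξ) (inr Ξ Z)) (M ∷ N ∷ [])

  X-injective : ∀ Ξ {M M' N N'} → X[ Ξ ] M N ≈ X[ Ξ ] M' N' → M ≈ M' × N ≈ N'
  X-injective Ξ {M} {M'} {N} {N'} q
    with SameHeadArgs⇒≈* (ϱ-atomic Ξ (inr Ξ Z) (inr Ξ Z) (M ∷ N ∷ []) (M' ∷ N' ∷ []) q)
  ... | p ∷ p' ∷ [] = p , p'

  -- Atomicity for fresh heads with no arguments stands in for confluence here.
  fresh-vars-distinct : ∀ Ξ → ¬ _≈_ {ι ∷ ι ∷ Ξ ++ Δ} (var Z) (var (S Z))
  fresh-vars-distinct Ξ q with ϱ-atomic (ι ∷ ι ∷ Ξ) Z (S Z) [] [] q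
  ... | ()

  E : Ne (ι ∷ ι ∷ Δ) ι
  E = body (nf X)

  X-β : ∀ Ξ M N → X[ Ξ ] M N ≈ subst (sub₂ (inr Ξ) M N) (embNe E)
  X-β Ξ M N = begin
    X[ Ξ ] M N
      ≡⟨ cong (λ t → app (app t M) N) (^-inr Ξ ϱ Z) ⟩
    app (app (rename (inr Ξ) X) M) N
      ≈⟨ app-cong (app-cong (≈-rename (inr Ξ) X≈λλE) ≈-refl) ≈-refl ⟩
    app (app (rename (inr Ξ) (lam (lam (embNe E)))) M) N
      ≈⟨ β₂-rename (inr Ξ) (embNe E) M N ⟩
    subst (sub₂ (inr Ξ) M N) (embNe E)
      ∎
    where
    open ≈-Reasoning
    X≈λλE : X ≈ lam (lam (embNe E))
    X≈λλE = ≈-trans (nf-sound X) (≡⇒≈ (embNf-𝟘𝟘 (nf X)))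

  X-cong-unused : ∀ Ξ {y M M' N N'} → ¬ OccNe y E →
    (∀ {C} (x : _ ∋ C) → ¬ OccNe y (nvar x) → sub₂ (inr Ξ) M N x ≡ sub₂ (inr Ξ) M' N' x) →
    X[ Ξ ] M N ≈ X[ Ξ ] M' N'
  X-cong-unused Ξ {M = M} {M'} {N} {N'} unused agree =
    ≈-resp₂ (≈-sym (X-β Ξ M N)) (≈-sym (X-β Ξ M' N')) (≡⇒≈ (subst-unused-ne E unused _ _ agree))

  first-arg-occurs : ¬ ¬ OccNe (S Z) E
  first-arg-occurs unused =
    fresh-vars-distinct (ι ∷ []) (proj₁ (X-injective (ι ∷ ι ∷ ι ∷ []) (X-cong-unused _ unused agree)))
    where
    agree : ∀ {C} (x : (ι ∷ ι ∷ Δ) ∋ C) → ¬ OccNe (S Z) (nvar x) →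
      sub₂ (inr (ι ∷ ι ∷ ι ∷ [])) (var Z) (var (S (S Z))) x ≡ sub₂ (inr _) (var (S Z)) (var (S (S Z))) x
    agree Z         _ = refl
    agree (S Z)     n = ⊥-elim (n here)
    agree (S (S x)) _ = refl

  second-arg-occurs : ¬ ¬ OccNe Z E
  second-arg-occurs unused =
    fresh-vars-distinct (ι ∷ []) (proj₂ (X-injective (ι ∷ ι ∷ ι ∷ []) (X-cong-unused _ unused agree)))
    where
    agree : ∀ {C} (x : (ι ∷ ι ∷ Δ) ∋ C) → ¬ OccNe Z (nvar x) →
      sub₂ (inr (ι ∷ ι ∷ ι ∷ [])) (var (S (S Z))) (var Z) x ≡ sub₂ (inr _) (var (S (S Z))) (var (S Z)) x
    agree Z         n = ⊥-elim (n here)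
    agree (S Z)     _ = refl
    agree (S (S x)) _ = refl

  no-diagonal-fixpoint : ∀ Ξ N → ¬ N ≈ X[ Ξ ] N N
  no-diagonal-fixpoint Ξ N N≈XNN = first-arg-occurs λ u∈E → second-arg-occurs λ v∈E →
    <-irrefl ⟪N⟫≡⟪E⟫ (occurring-<-ne good E u∈E v∈E (λ ()))
    where
    γ : SEnv (ι ∷ ι ∷ Δ)
    γ x = ⟪ sub₂ (inr Ξ) N N x ⟫ generic

    good : Good γ
    good Z         ()
    good (S Z)     ()
    good (S (S x)) _ = refl

    ⟪N⟫≡⟪E⟫ : ⟪ N ⟫ generic ≡ ⟪ embNe E ⟫ γ
    ⟪N⟫≡⟪E⟫ = begin
      ⟪ N ⟫ generic                                  ≡⟨ ⟪⟫-sound N≈XNN generic-refl ⟩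
      ⟪ X[ Ξ ] N N ⟫ generic                         ≡⟨ ⟪⟫-sound (X-β Ξ N N) generic-refl ⟩
      ⟪ subst (sub₂ (inr Ξ) N N) (embNe E) ⟫ generic ≡⟨ ⟪subst⟫ _ (embNe E) generic-refl ⟩
      ⟪ embNe E ⟫ γ                                  ∎
      where open ≡-Reasoning

  σ : Sub (𝟙 ∷ 𝟙 ∷ []) Δ
  σ Z     = lam (app (app (rename S X) (var Z)) (var Z))
  σ (S Z) = lam (app (app (rename S X) (app (app (rename S X) (var Z)) (var Z))) (var Z))

  X⁺ : ∀ Ξ → Tm (Ξ ++ Δ) ι → Tm (Ξ ++ Δ) 𝟘𝟘
  X⁺ Ξ M = subst (sub0 M) (rename (extR (inr Ξ)) (rename S X))

  X⁺≡ : ∀ Ξ M → X⁺ Ξ M ≡ (ϱ ^ Ξ) (inr Ξ Z)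
  X⁺≡ Ξ M = trans (subst-sub0-weaken (inr Ξ) M X) (sym (^-inr Ξ ϱ Z))

  σ-args : ∀ Ξ {C} → (𝟙 ∷ 𝟙 ∷ []) ∋ C → Args (Ξ ++ Δ) C → Args (Ξ ++ Δ) 𝟘𝟘
  σ-args Ξ Z     (M ∷ []) = M ∷ M ∷ []
  σ-args Ξ (S Z) (M ∷ []) = X[ Ξ ] M M ∷ M ∷ []

  σ-unfold : ∀ Ξ {C} (c : (𝟙 ∷ 𝟙 ∷ []) ∋ C) (Ms : Args (Ξ ++ Δ) C) →
    apps ((σ ^ Ξ) (inr Ξ c)) Ms ≈ apps ((ϱ ^ Ξ) (inr Ξ Z)) (σ-args Ξ c Ms)
  σ-unfold Ξ Z (M ∷ []) = begin
    app ((σ ^ Ξ) (inr Ξ Z)) M      ≡⟨ cong (λ t → app t M) (^-inr Ξ σ Z) ⟩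
    app (rename (inr Ξ) (σ Z)) M   ≈⟨ β _ M ⟩
    app (app (X⁺ Ξ M) M) M         ≡⟨ cong (λ t → app (app t M) M) (X⁺≡ Ξ M) ⟩
    X[ Ξ ] M M                     ∎
    where open ≈-Reasoning
  σ-unfold Ξ (S Z) (M ∷ []) = begin
    app ((σ ^ Ξ) (inr Ξ (S Z))) M                  ≡⟨ cong (λ t → app t M) (^-inr Ξ σ (S Z)) ⟩
    app (rename (inr Ξ) (σ (S Z))) M               ≈⟨ β _ M ⟩
    app (app (X⁺ Ξ M) (app (app (X⁺ Ξ M) M) M)) M
      ≡⟨ cong (λ t → app (app t (app (app t M) M)) M) (X⁺≡ Ξ M) ⟩
    X[ Ξ ] (X[ Ξ ] M M) M                          ∎
    where open ≈-Reasoning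

  σ-args-separate : ∀ Ξ {C C'} (c : (𝟙 ∷ 𝟙 ∷ []) ∋ C) (c' : (𝟙 ∷ 𝟙 ∷ []) ∋ C')
    (Ms : Args (Ξ ++ Δ) C) (Ns : Args (Ξ ++ Δ) C') →
    σ-args Ξ c Ms ≈* σ-args Ξ c' Ns → SameHeadArgs (inr Ξ c) Ms (inr Ξ c') Ns
  σ-args-separate Ξ Z     Z     (M ∷ []) (N ∷ []) (M≈N ∷ _)      = same (M≈N ∷ [])
  σ-args-separate Ξ (S Z) (S Z) (M ∷ []) (N ∷ []) (_ ∷ M≈N ∷ []) = same (M≈N ∷ [])
  σ-args-separate Ξ Z     (S Z) (M ∷ []) (N ∷ []) (M≈XNN ∷ M≈N ∷ []) =
    ⊥-elim (no-diagonal-fixpoint Ξ N (≈-trans (≈-sym M≈N) M≈XNN))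
  σ-args-separate Ξ (S Z) Z     (M ∷ []) (N ∷ []) (XMM≈N ∷ M≈N ∷ []) =
    ⊥-elim (no-diagonal-fixpoint Ξ M (≈-trans M≈N (≈-sym XMM≈N)))

  σ-inl : ∀ Ξ {C} (x : Ξ ∋ C) (Ms : Args (Ξ ++ Δ) C) →
    apps ((σ ^ Ξ) (inl Ξ x)) Ms ≈ apps ((ϱ ^ Ξ) (inl Ξ x)) Ms
  σ-inl Ξ x Ms = ≡⇒≈ (cong (λ t → apps t Ms) (trans (^-inl Ξ σ x) (sym (^-inl Ξ ϱ x))))

  σ-atomic : IsAtomicReduction σ
  σ-atomic Ξ a b Ms Ns q with view Ξ a | view Ξ b
  ... | left x  | left y   = SameHeadArgs-inl Ξ x y
    (ϱ-atomic Ξ (inl Ξ x) (inl Ξ y) Ms Ns (≈-resp₂ (σ-inl Ξ x Ms) (σ-inl Ξ y Ns) q))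
  ... | left x  | right c  = ⊥-elim (¬SameHeadArgs-inl-inr Ξ x Z
    (ϱ-atomic Ξ (inl Ξ x) (inr Ξ Z) Ms (σ-args Ξ c Ns) (≈-resp₂ (σ-inl Ξ x Ms) (σ-unfold Ξ c Ns) q)))
  ... | right c | left y   = ⊥-elim (¬SameHeadArgs-inr-inl Ξ y Z
    (ϱ-atomic Ξ (inr Ξ Z) (inl Ξ y) (σ-args Ξ c Ms) Ns (≈-resp₂ (σ-unfold Ξ c Ms) (σ-inl Ξ y Ns) q)))
  ... | right c | right c' = σ-args-separate Ξ c c' Ms Ns (SameHeadArgs⇒≈*
    (ϱ-atomic Ξ (inr Ξ Z) (inr Ξ Z) (σ-args Ξ c Ms) (σ-args Ξ c' Ns)
      (≈-resp₂ (σ-unfold Ξ c Ms) (σ-unfold Ξ c' Ns) q)))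

args-⟦⟧ : (Γ : Ctx) → args ⟦ Γ ⟧ ≡ Γ
args-⟦⟧ []      = refl
args-⟦⟧ (A ∷ Γ) = cong (A ∷_) (args-⟦⟧ Γ)

⟦⟧-injective : (Γ Γ' : Ctx) → ⟦ Γ ⟧ ≡ ⟦ Γ' ⟧ → Γ ≡ Γ'
⟦⟧-injective Γ Γ' p = trans (sym (args-⟦⟧ Γ)) (trans (cong args p) (args-⟦⟧ Γ'))

lemmaL : (A : Ty) → ⟦ 𝟘𝟘 ∷ [] ⟧ ≤ᵃ A → Atomic A
lemmaL A (Γ , Δ , ⟦Γ⟧≡ , ⟦Δ⟧≡A , ϱ , ϱ-atomic) with ⟦⟧-injective Γ (𝟘𝟘 ∷ []) ⟦Γ⟧≡
... | refl = 𝟙 ∷ 𝟙 ∷ [] , Δ , refl , ⟦Δ⟧≡A , σ , σ-atomic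
  where open Diagonal ϱ ϱ-atomic
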